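{- Let $H$ be an undirected graph with nonnegative edge weights, source $s$, shortest path tree $\textsc{Spt}_H(s)$, a vertex $r$, and primary path $\mathcal{P}$ the $s$–$r$ path in $\textsc{Spt}_H(s)$. Let $t$ be a vertex of $H$ and $p=\textsc{Lca}(t,r)$ in $\textsc{Spt}_H(s)$. Then all candidate departing paths from $s$ to $t$ avoiding edges on the $s$–$p$ path also avoid $p$, and for every edge $e$ on the $p$–$r$ subpath of $\mathcal{P}$, $st\diamond e=st$.
   Context: For $e\in\mathcal{P}$, a departing path avoiding $e$ is an $s$–$t$ path avoiding $e$ that leaves $\mathcal{P}$ above $e$ and uses no vertex of $\mathcal{P}$ after (farther from $s$ than) $e$. The candidate departing path for $e$ is a minimum-length departing path avoiding $e$, ties broken by preferring (1) paths that diverge from and merge with the $s$–$t$ path once, (2) divergence point closest to $s$, (3) lexicographically smallest. $st\diamond e$ is the replacement path: the shortest $s$–$t$ path avoiding $e$ chosen by the same rules (1)–(3); $st$ is the tree path.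
   Formalization: The edge weights of H are nonnegative rationals. -}

module Defs where

open import Data.Nat as ℕ using (ℕ; zero; suc)
open import Data.Fin as Fin using (Fin)
open import Data.List using (List; []; _∷_; _++_; _∷ʳ_; length)
open import Data.List.Membership.Propositional using (_∈_; _∉_)
open import Data.List.Relation.Unary.Linked using (Linked)
open import Data.List.Relation.Unary.Unique.Propositional using (Unique)
open import Data.List.Relation.Binary.Lex using (Lex-≤)
open import Data.Rational as ℚ using (ℚ; 0ℚ)
open import Data.Product using (Σ; ∃; ∃-syntax; _×_; _,_)
open import Data.Sum using (_⊎_)
open import Relation.Nullary using (¬_; yes; no)
open import Relation.Binary.PropositionalEquality using (_≡_; _≢_)

-- Undirected (simple) graph on vertex set Fin n with nonnegative weights.
-- Weights are rationals (the paper uses nonnegative reals).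

record WGraph (n : ℕ) : Set₁ where
  field
    Edge     : Fin n → Fin n → Set
    Edge-sym : ∀ {u v} → Edge u v → Edge v u
    w        : Fin n → Fin n → ℚ
    w-sym    : ∀ u v → w u v ≡ w v u
    w-nonneg : ∀ u v → 0ℚ ℚ.≤ w u v

module _ {n : ℕ} (G : WGraph n) where
  open WGraph G

  IsPath : List (Fin n) → Fin n → Fin n → Set
  IsPath Q a b =
    (Σ (List (Fin n)) λ xs → Q ≡ a ∷ xs) ×
    (Σ (List (Fin n)) λ ys → Q ≡ ys ∷ʳ b) ×
    Linked Edge Q × Unique Q

  len : List (Fin n) → ℚ
  len (x ∷ y ∷ xs) = w x y ℚ.+ len (y ∷ xs)
  len _            = 0ℚ

  Reachable : Fin n → Fin n → Set
  Reachable a b = ∃ λ Q → IsPath Q a b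

  IsShortest : List (Fin n) → Fin n → Fin n → Set
  IsShortest Q a b = IsPath Q a b × (∀ Q' → IsPath Q' a b → len Q ℚ.≤ len Q')

  -- Shortest path tree rooted at s, given by its tree paths tp v (the s–v
  -- path in the tree) for every vertex v reachable from s: each tree path
  -- is a shortest path, and the family is prefix closed (so the union of
  -- the tree paths is a tree rooted at s).
  record IsSPT (s : Fin n) (tp : Fin n → List (Fin n)) : Set where
    field
      tp-shortest : ∀ v → Reachable s v → IsShortest (tp v) s v
      tp-prefix   : ∀ v → Reachable s v → ∀ xs u ys →
                    tp v ≡ xs ++ u ∷ ys → tp u ≡ xs ∷ʳ u

module _ {n : ℕ} where

  Consec : Fin n → Fin n → List (Fin n) → Set
  Consec a b Q = ∃[ xs ] ∃[ ys ] Q ≡ xs ++ a ∷ b ∷ ys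

  UsesEdge : Fin n → Fin n → List (Fin n) → Set
  UsesEdge a b Q = Consec a b Q ⊎ Consec b a Q

  AvoidsEdge : Fin n → Fin n → List (Fin n) → Set
  AvoidsEdge a b Q = ¬ UsesEdge a b Q

  lcpLen : List (Fin n) → List (Fin n) → ℕ
  lcpLen (x ∷ xs) (y ∷ ys) with x Fin.≟ y
  ... | yes _ = suc (lcpLen xs ys)
  ... | no  _ = 0
  lcpLen _ _ = 0

  IsLCA : (Fin n → List (Fin n)) → Fin n → Fin n → Fin n → Set
  IsLCA tp t r p =
    ∃[ pre ] ∃[ xs ] ∃[ ys ]
      tp t ≡ (pre ∷ʳ p) ++ xs × tp r ≡ (pre ∷ʳ p) ++ ys ×
      (∀ a b xs' ys' → xs ≡ a ∷ xs' → ys ≡ b ∷ ys' → a ≢ b)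

  -- Q diverges from and merges with the path st exactly once:
  -- Q = as ++ mid ++ cs, st = as ++ bs ++ cs, mid disjoint from st, Q ≢ st
  Once : List (Fin n) → List (Fin n) → Set
  Once st Q =
    Q ≢ st ×
    (∃[ as ] ∃[ bs ] ∃[ cs ] ∃[ mid ]
      as ≢ [] × cs ≢ [] × Q ≡ as ++ mid ++ cs × st ≡ as ++ bs ++ cs ×
      (∀ x → x ∈ mid → x ∉ st))

  -- rule (1) as a rank: 0 = st itself (no divergence), 1 = diverges and
  -- merges once, 2 = otherwise
  data RankIs (st Q : List (Fin n)) : ℕ → Set where
    rank0 : Q ≡ st → RankIs st Q 0
    rank1 : Once st Q → RankIs st Q 1
    rank2 : Q ≢ st → ¬ Once st Q → RankIs st Q 2

  LexLE : List (Fin n) → List (Fin n) → Set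
  LexLE = Lex-≤ _≡_ Fin._<_

module _ {n : ℕ} (G : WGraph n) where

  -- Q is at least as preferred as Q' : by length, then rule (1), then
  -- rule (2) (divergence point from st closer to s), then rule (3) (lex)
  Preferred : List (Fin n) → List (Fin n) → List (Fin n) → Set
  Preferred st Q Q' =
    ∀ k k' → RankIs st Q k → RankIs st Q' k' →
      len G Q ℚ.< len G Q' ⊎
      (len G Q ≡ len G Q' ×
        (k ℕ.< k' ⊎
        (k ≡ k' ×
          (lcpLen Q st ℕ.< lcpLen Q' st ⊎
          (lcpLen Q st ≡ lcpLen Q' st × LexLE Q Q')))))

  -- Q is a departing path avoiding the edge (u , v) of the primary path P
  -- (u closer to s than v), from s to t
  Departing : (P : List (Fin n)) → Fin n → Fin n → Fin n → Fin n →
              List (Fin n) → Set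
  Departing P s t u v Q =
    IsPath G Q s t × AvoidsEdge u v Q ×
    ∃[ A ] ∃[ B ] (P ≡ A ++ u ∷ v ∷ B ×
      -- leaves P at a vertex at or above u
      lcpLen Q P ℕ.≤ suc (length A) × lcpLen Q P ℕ.< length Q ×
      (∀ x → x ∈ Q → x ∉ v ∷ B))

  IsCandidateDeparting : (P st : List (Fin n)) → Fin n → Fin n → Fin n →
                         Fin n → List (Fin n) → Set
  IsCandidateDeparting P st s t u v Q =
    Departing P s t u v Q ×
    (∀ Q' → Departing P s t u v Q' → Preferred st Q Q')

  IsReplacement : (st : List (Fin n)) → Fin n → Fin n → Fin n → Fin n →
                  List (Fin n) → Set
  IsReplacement st s t u v Q =
    (IsPath G Q s t × AvoidsEdge u v Q) ×
    (∀ Q' → IsPath G Q' s t → AvoidsEdge u v Q' → Preferred st Q Q')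

{-# OPTIONS --safe #-}
module Submission where

-- An edge e of the s–p tree path lies above p on the primary path, and a departing path avoiding
-- e may not touch the primary path below e, so it misses p. Below p the primary path and the tree path to t share no vertex, since a common vertex
-- x would force both to extend the tree path to x past p in the same direction. Hence edges of
-- the p–r subpath are off the tree path st, which is shortest and the rank-0 choice of rule (1),
-- so st ⋄ e = st.

open import Defs
open import Data.Nat using (ℕ; s≤s; z≤n)
open import Data.Fin as Fin using (Fin)
open import Data.List using (List; []; _∷_; _++_; _∷ʳ_; [_])
open import Data.List.Properties using (++-assoc; ++-cancelˡ; ∷-injectiveʳ; ∷ʳ-injectiveˡ; ≡-dec)
open import Data.List.Membership.Propositional using (_∈_; _∉_)
open import Data.List.Membership.Propositional.Properties using (∈-++⁺ˡ; ∈-++⁺ʳ; ∈-∃++)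
open import Data.List.Relation.Unary.Any using (here; there)
open import Data.List.Relation.Unary.AllPairs using (_∷_)
open import Data.List.Relation.Unary.Unique.Propositional using (Unique)
open import Data.List.Relation.Unary.Unique.Propositional.Properties using (Unique[x∷xs]⇒x∉xs)
open import Data.List.Relation.Binary.Pointwise using (≡⇒Pointwise-≡)
import Data.List.Relation.Binary.Lex.Strict as Lex
open import Data.Rational as ℚ using (ℚ)
import Data.Rational.Properties as ℚ
open import Data.Product using (∃; _×_; _,_; proj₁; proj₂)
open import Data.Sum using (_⊎_; inj₁; inj₂; [_,_]′)
open import Data.Empty using (⊥)
open import Function using (_∘_)
open import Relation.Binary using (tri<; tri≈; tri>)
open import Relation.Nullary using (¬_; Dec; yes; no; contradiction)
open import Relation.Nullary.Decidable using (decidable-stable; ¬¬-excluded-middle)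
open import Relation.Nullary.Negation using (¬¬-map)
open import Relation.Binary.PropositionalEquality using (_≡_; _≢_; refl; sym; trans; cong; subst; module ≡-Reasoning)

module _ {a} {A : Set a} where

  ∷ʳ-∈-suffix : ∀ xs {x : A} ys {y} zs → xs ∷ʳ x ≡ ys ++ y ∷ zs → x ∈ y ∷ zs
  ∷ʳ-∈-suffix xs       []            zs eq = subst (_ ∈_) eq (∈-++⁺ʳ xs (here refl))
  ∷ʳ-∈-suffix []       (_ ∷ [])      zs ()
  ∷ʳ-∈-suffix []       (_ ∷ _ ∷ _)   zs ()
  ∷ʳ-∈-suffix (_ ∷ xs) (_ ∷ ys)      zs eq = ∷ʳ-∈-suffix xs ys zs (∷-injectiveʳ eq)

  Unique-suffix : ∀ xs xs' {x : A} {ys ys'} → Unique (xs ++ x ∷ ys) →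
                  xs ++ x ∷ ys ≡ xs' ++ x ∷ ys' → ys ≡ ys'
  Unique-suffix []       []        _       refl = refl
  Unique-suffix []       (_ ∷ xs') u       refl = contradiction (∈-++⁺ʳ xs' (here refl)) (Unique[x∷xs]⇒x∉xs u)
  Unique-suffix (_ ∷ xs) []        u       refl = contradiction (∈-++⁺ʳ xs (here refl)) (Unique[x∷xs]⇒x∉xs u)
  Unique-suffix (_ ∷ xs) (_ ∷ xs') (_ ∷ u) eq   = Unique-suffix xs xs' u (∷-injectiveʳ eq)

module _ {n : ℕ} where

  Consec-∈-tail : ∀ {u v x : Fin n} {xs} → Consec u v (x ∷ xs) → v ∈ xs
  Consec-∈-tail ([]     , _ , refl) = here refl
  Consec-∈-tail (_ ∷ ys , _ , refl) = ∈-++⁺ʳ ys (there (here refl))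

  Consec-∈ : ∀ {u v : Fin n} {Q} → Consec u v Q → u ∈ Q × v ∈ Q
  Consec-∈ (ys , _ , refl) = ∈-++⁺ʳ ys (here refl) , ∈-++⁺ʳ ys (there (here refl))

  UsesEdge-∈ : ∀ {u v : Fin n} {Q} → UsesEdge u v Q → v ∈ Q
  UsesEdge-∈ = [ proj₂ ∘ Consec-∈ , proj₁ ∘ Consec-∈ ]′

  Rank-zero⇒≡ : ∀ {st Q : List (Fin n)} → RankIs st Q 0 → Q ≡ st
  Rank-zero⇒≡ (rank0 Q≡st) = Q≡st

  -- Once comes with no decision procedure, so a rank exists only up to double negation; this
  -- suffices below because the conclusion drawn from it, Q ≡ st, is decidable.
  ¬¬-ranked : ∀ (st Q : List (Fin n)) → ¬ ¬ ∃ (RankIs st Q)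
  ¬¬-ranked st Q = ¬¬-map ranked ¬¬-excluded-middle
    where
    ranked : Dec (Once st Q) → ∃ (RankIs st Q)
    ranked once? with ≡-dec Fin._≟_ Q st | once?
    ... | yes Q≡st | _       = 0 , rank0 Q≡st
    ... | no  Q≢st | yes o   = 1 , rank1 o
    ... | no  Q≢st | no  ¬o  = 2 , rank2 Q≢st ¬o

≤⇒<⊎≡ : ∀ {p q : ℚ} → p ℚ.≤ q → p ℚ.< q ⊎ p ≡ q
≤⇒<⊎≡ {p} {q} p≤q with ℚ.<-cmp p q
... | tri< p<q _ _ = inj₁ p<q
... | tri≈ _ p≡q _ = inj₂ p≡q
... | tri> _ _ q<p = contradiction (ℚ.≤-<-trans p≤q q<p) (ℚ.<-irrefl refl)

module _ {n : ℕ} (G : WGraph n) where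

  self-preferred : ∀ {st Q : List (Fin n)} → len G st ℚ.≤ len G Q → Preferred G st st Q
  self-preferred st≤Q _ _ (rank0 _) Q-rank with ≤⇒<⊎≡ st≤Q | Q-rank
  ... | inj₁ st<Q | _          = inj₁ st<Q
  ... | inj₂ _    | rank0 refl =
    inj₂ (refl , inj₂ (refl , inj₂ (refl , Lex.≤-reflexive _≡_ Fin._<_ (≡⇒Pointwise-≡ refl))))
  ... | inj₂ st≡Q | rank1 _    = inj₂ (st≡Q , inj₁ (s≤s z≤n))
  ... | inj₂ st≡Q | rank2 _ _  = inj₂ (st≡Q , inj₁ (s≤s z≤n))
  self-preferred _ _ _ (rank1 (st≢st , _)) _ = contradiction refl st≢st
  self-preferred _ _ _ (rank2 st≢st _)     _ = contradiction refl st≢st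

  preferred-over-self⇒≡ : ∀ {st Q : List (Fin n)} → len G st ℚ.≤ len G Q →
                          Preferred G st Q st → Q ≡ st
  preferred-over-self⇒≡ {st} {Q} st≤Q Q≽st =
    decidable-stable (≡-dec Fin._≟_ Q st) (¬¬-map (ranked⇒≡ ∘ proj₂) (¬¬-ranked st Q))
    where
    ranked⇒≡ : ∀ {k} → RankIs st Q k → Q ≡ st
    ranked⇒≡ rank with Q≽st _ 0 rank (rank0 refl)
    ... | inj₁ Q<st                  = contradiction (ℚ.≤-<-trans st≤Q Q<st) (ℚ.<-irrefl refl)
    ... | inj₂ (_ , inj₂ (refl , _)) = Rank-zero⇒≡ rank

  shortest-avoiding⇒own-replacement :
    ∀ {st s t u v} → IsShortest G st s t → AvoidsEdge u v st →
    IsReplacement G st s t u v st × (∀ Q → IsReplacement G st s t u v Q → Q ≡ st)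
  shortest-avoiding⇒own-replacement (st-path , st-minimal) st-avoids =
      ((st-path , st-avoids) , λ Q Q-path _ → self-preferred (st-minimal Q Q-path))
    , λ Q ((Q-path , _) , Q-best) → preferred-over-self⇒≡ (st-minimal Q Q-path) (Q-best _ st-path st-avoids)

  Departing-∉-below : ∀ {P s t u v Q A B x} → Unique P → Departing G P s t u v Q →
                      P ≡ A ++ u ∷ v ∷ B → x ∈ v ∷ B → x ∉ Q
  Departing-∉-below {v = v} {A = A} {B} {x} P-unique (_ , _ , A' , B' , P≡A'uvB' , _ , _ , Q-off-below) P≡AuvB x∈vB x∈Q =
    Q-off-below x x∈Q (subst (x ∈_) vB≡vB' x∈vB)
    where
    vB≡vB' : v ∷ B ≡ v ∷ B'
    vB≡vB' = Unique-suffix A A' (subst Unique P≡AuvB P-unique) (trans (sym P≡AuvB) P≡A'uvB')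

  Departing-∉-ancestor : ∀ {P s t u v Q pre p ys} → Unique P → P ≡ (pre ∷ʳ p) ++ ys →
                         Consec u v (pre ∷ʳ p) → Departing G P s t u v Q → p ∉ Q
  Departing-∉-ancestor {P} {u = u} {v} {pre = pre} {p} {ys} P-unique P≡ (as , bs , pre∷ʳp≡) departing =
    Departing-∉-below P-unique departing P≡asuvbsys (∈-++⁺ˡ p∈vbs)
    where
    open ≡-Reasoning
    P≡asuvbsys : P ≡ as ++ u ∷ v ∷ bs ++ ys
    P≡asuvbsys = begin
      P                          ≡⟨ P≡ ⟩
      (pre ∷ʳ p) ++ ys           ≡⟨ cong (_++ ys) pre∷ʳp≡ ⟩
      (as ++ u ∷ v ∷ bs) ++ ys   ≡⟨ ++-assoc as (u ∷ v ∷ bs) ys ⟩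
      as ++ u ∷ v ∷ bs ++ ys     ∎
    p∈vbs : p ∈ v ∷ bs
    p∈vbs = ∷ʳ-∈-suffix pre (as ++ [ u ]) bs (trans pre∷ʳp≡ (sym (++-assoc as [ u ] (v ∷ bs))))

module _ {n : ℕ} {G : WGraph n} {s : Fin n} {tp : Fin n → List (Fin n)} (spt : IsSPT G s tp) where
  open IsSPT spt

  tp-Unique : ∀ {v} → Reachable G s v → Unique (tp v)
  tp-Unique v-reachable = proj₂ (proj₂ (proj₂ (proj₁ (tp-shortest _ v-reachable))))

  tp-shared-prefix : ∀ {a b x xs ys xs' ys'} → Reachable G s a → Reachable G s b →
                     tp a ≡ xs ++ x ∷ ys → tp b ≡ xs' ++ x ∷ ys' → xs ≡ xs'
  tp-shared-prefix {a} {b} {x} {xs} {ys} {xs'} {ys'} a-reachable b-reachable tp-a≡ tp-b≡ =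
    ∷ʳ-injectiveˡ xs xs' (trans (sym (tp-prefix a a-reachable xs x ys tp-a≡))
                               (tp-prefix b b-reachable xs' x ys' tp-b≡))

  tp-branches-disjoint : ∀ {t r pre xs ys x} → Reachable G s t → Reachable G s r →
    tp t ≡ pre ++ xs → tp r ≡ pre ++ ys →
    (∀ a b xs' ys' → xs ≡ a ∷ xs' → ys ≡ b ∷ ys' → a ≢ b) →
    x ∈ ys → x ∉ tp t
  tp-branches-disjoint {pre = pre} {xs} {ys} {x} t-reachable r-reachable tp-t≡ tp-r≡ diverge x∈ys x∈tp-t
    with ∈-∃++ x∈ys | ∈-∃++ x∈tp-t
  ... | ys₁ , ys₂ , ys≡ | zs₁ , zs₂ , tp-t≡zs₁xzs₂ = same-head ys₁ xs≡ys₁xzs₂ ys≡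
    where
    zs₁≡ : zs₁ ≡ pre ++ ys₁
    zs₁≡ = tp-shared-prefix t-reachable r-reachable tp-t≡zs₁xzs₂
             (trans tp-r≡ (trans (cong (pre ++_) ys≡) (sym (++-assoc pre ys₁ (x ∷ ys₂)))))
    xs≡ys₁xzs₂ : xs ≡ ys₁ ++ x ∷ zs₂
    xs≡ys₁xzs₂ = ++-cancelˡ pre xs (ys₁ ++ x ∷ zs₂)
      (trans (sym tp-t≡) (trans tp-t≡zs₁xzs₂ (trans (cong (_++ x ∷ zs₂) zs₁≡) (++-assoc pre ys₁ (x ∷ zs₂)))))
    same-head : ∀ ws → xs ≡ ws ++ x ∷ zs₂ → ys ≡ ws ++ x ∷ ys₂ → ⊥
    same-head []      xs≡ ys≡ = diverge x x zs₂ ys₂ xs≡ ys≡ refl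
    same-head (w ∷ _) xs≡ ys≡ = diverge w w _ _ xs≡ ys≡ refl

lemma11 : {n : ℕ} (H : WGraph n) (s r t p : Fin n) (tp : Fin n → List (Fin n)) →
    IsSPT H s tp → Reachable H s r → Reachable H s t → IsLCA tp t r p →
    (∀ u v → Consec u v (tp p) → ∀ Q →
      IsCandidateDeparting H (tp r) (tp t) s t u v Q → p ∉ Q) ×
    (∀ ys → tp r ≡ tp p ++ ys → ∀ u v → Consec u v (p ∷ ys) →
      IsReplacement H (tp t) s t u v (tp t) ×
      (∀ Q → IsReplacement H (tp t) s t u v Q → Q ≡ tp t))
lemma11 H s r t p tp spt r-reachable t-reachable (pre , xs , ys , tp-t≡ , tp-r≡ , diverge) =
    (λ u v uv Q candidate →
      Departing-∉-ancestor H (tp-Unique spt r-reachable) tp-r≡ (subst (Consec u v) tp-p≡ uv) (proj₁ candidate))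
  , λ ys' tp-r≡tp-p++ys' u v uv →
      shortest-avoiding⇒own-replacement H (tp-shortest t t-reachable)
        (below-p-∉-tp-t tp-r≡tp-p++ys' (Consec-∈-tail uv) ∘ UsesEdge-∈)
  where
  open IsSPT spt

  tp-p≡ : tp p ≡ pre ∷ʳ p
  tp-p≡ = tp-prefix r r-reachable pre p ys (trans tp-r≡ (++-assoc pre [ p ] ys))

  below-p-∉-tp-t : ∀ {ys' x} → tp r ≡ tp p ++ ys' → x ∈ ys' → x ∉ tp t
  below-p-∉-tp-t {ys'} tp-r≡tp-p++ys' x∈ys' =
    tp-branches-disjoint spt t-reachable r-reachable tp-t≡ tp-r≡ diverge (subst (_ ∈_) ys'≡ys x∈ys')
    where
    ys'≡ys : ys' ≡ ys
    ys'≡ys = ++-cancelˡ (pre ∷ʳ p) ys' ys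
               (trans (cong (_++ ys') (sym tp-p≡)) (trans (sym tp-r≡tp-p++ys') tp-r≡))
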